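{- Let $\mathcal{G}$ be a graph and $\alpha,\beta$ positive integers. If there exists an $(\alpha\mid\beta)$-cointersection representation of $\mathcal{G}$, then $\alpha\beta\ge\theta_1(\mathcal{G})$. Consequently, $\theta^{c}(\mathcal{G})\ge\min\{\alpha+\beta:\ \alpha,\beta\in\mathbb{Z}_{\ge1},\ \alpha\beta\ge\theta_1(\mathcal{G})\}$.
   Context: Graphs are finite, simple and undirected. For a graph $\mathcal{G}=(\mathcal{V},\mathcal{E})$ and positive integers $\alpha,\beta$, an $(\alpha\mid\beta)$-cointersection representation (CIR) of $\mathcal{G}$ consists of two disjoint finite sets of features $\mathcal{A},\mathcal{B}$ with $|\mathcal{A}|=\alpha$, $|\mathcal{B}|=\beta$, together with an assignment to each vertex $v$ of subsets $A_v\subseteq\mathcal{A}$, $B_v\subseteq\mathcal{B}$ (possibly empty), such that for all distinct $u,v\in\mathcal{V}$: $(u,v)\in\mathcal{E}$ if and only if $A_u\cap A_v\neq\varnothing$ and $B_u\cap B_v\neq\varnothing$. The cointersection number $\theta^{c}(\mathcal{G})$ is the minimum of $\alpha+\beta$ over all CIRs of $\mathcal{G}$. The intersection number $\theta_1(\mathcal{G})$ is the minimum size of a nonempty finite set $F$ for which there exist subsets $S_v\subseteq F$ (possibly empty) such that distinct $u,v$ are adjacent iff $S_u\cap S_v\ne\varnothing$; for a graph with at least one edge this equals the minimum number of cliques needed to cover all edges, and for an edgeless graph it equals $1$. -}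

module Defs where

open import Data.Nat using (ℕ; _≤_; _*_; _+_; _≥_)
open import Data.Fin using (Fin)
open import Data.Fin.Subset using (Subset; _∩_; Nonempty)
open import Data.Product using (Σ; _×_; ∃; ∃-syntax)
open import Relation.Binary.PropositionalEquality using (_≡_)
open import Relation.Nullary using (¬_)
open import Function.Bundles using (_⇔_)

record Graph : Set₁ where
  field
    n     : ℕ
    Adj   : Fin n → Fin n → Set
    sym   : ∀ {u v} → Adj u v → Adj v u
    irrefl : ∀ {v} → ¬ Adj v v

open Graph public

-- An (α | β)-cointersection representation: feature sets Fin α and Fin β
-- (disjoint by construction), subsets A v ⊆ Fin α, B v ⊆ Fin β,
-- such that distinct u,v are adjacent iff A u ∩ A v ≠ ∅ and B u ∩ B v ≠ ∅.
record CIR (G : Graph) (α β : ℕ) : Set where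
  field
    A   : Fin (n G) → Subset α
    B   : Fin (n G) → Subset β
    rep : ∀ u v → ¬ u ≡ v →
          Adj G u v ⇔ (Nonempty (A u ∩ A v) × Nonempty (B u ∩ B v))

record IR (G : Graph) (k : ℕ) : Set where
  field
    S   : Fin (n G) → Subset k
    rep : ∀ u v → ¬ u ≡ v → Adj G u v ⇔ Nonempty (S u ∩ S v)

IsIntersectionNumber : Graph → ℕ → Set
IsIntersectionNumber G t =
  (1 ≤ t × IR G t) × (∀ k → 1 ≤ k → IR G k → t ≤ k)

IsCointersectionNumber : Graph → ℕ → Set
IsCointersectionNumber G t =
  (∃[ α ] ∃[ β ] (1 ≤ α × 1 ≤ β × α + β ≡ t × CIR G α β)) ×
  (∀ α β → 1 ≤ α → 1 ≤ β → CIR G α β → t ≤ α + β)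

module Submission where

-- Given an (α | β)-cointersection representation (A, B) of G,
-- take as new feature set the product Fin α × Fin β, encoded as Fin (α * β)
-- via Data.Fin.combine / remQuot, and give each vertex v the "rectangle"
-- S v = A v ⊗ B v.  Two rectangles meet iff their sides meet pairwise:
--   (p ⊗ q) ∩ (p′ ⊗ q′) ≠ ∅  ⇔  p ∩ p′ ≠ ∅ and q ∩ q′ ≠ ∅,
-- which is exactly the adjacency condition of a CIR, so S is an intersection
-- representation of G with α * β ≥ 1 features; minimality of θ₁ gives
-- θ₁ ≤ α * β.  The second claim follows by applying this to a CIR that
-- realises θᶜ.

open import Defs hiding (sym)
open import Data.Nat using (ℕ; _≤_; _*_; _+_)
open import Data.Nat.Properties using (≤-reflexive; *-mono-≤)
open import Data.Product using (_×_; ∃-syntax; _,_; proj₁; proj₂)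
open import Data.Bool using (Bool; true; false; _∧_)
open import Data.Fin using (Fin; combine; remQuot)
open import Data.Fin.Properties using (remQuot-combine)
open import Data.Fin.Subset using (Subset; _∩_; _∈_; Nonempty)
open import Data.Fin.Subset.Properties using (x∈p∩q⁺; x∈p∩q⁻)
open import Data.Vec using (lookup; tabulate)
open import Data.Vec.Properties using ([]=⇒lookup; lookup⇒[]=; lookup∘tabulate)
open import Relation.Binary.PropositionalEquality using (_≡_; refl; trans; sym; subst)
open import Function.Bundles using (_⇔_; mk⇔; Equivalence)
open import Function.Construct.Composition using (_⇔-∘_)
open import Function.Construct.Symmetry using (⇔-sym)

private
  variable
    m : ℕ

∈⇔lookup : {x : Fin m} {p : Subset m} → x ∈ p ⇔ lookup p x ≡ true
∈⇔lookup {x = x} {p} = mk⇔ []=⇒lookup (lookup⇒[]= x p)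

∧≡true⇔ : {a b : Bool} → a ∧ b ≡ true ⇔ (a ≡ true × b ≡ true)
∧≡true⇔ {true}  {true}  = mk⇔ (λ _ → refl , refl) (λ _ → refl)
∧≡true⇔ {true}  {false} = mk⇔ (λ ()) proj₂
∧≡true⇔ {false} {_}     = mk⇔ (λ ()) proj₁

module _ {m k : ℕ} where

  row : Fin (m * k) → Fin m
  row x = proj₁ (remQuot {m} k x)

  col : Fin (m * k) → Fin k
  col x = proj₂ (remQuot {m} k x)

  _⊗_ : Subset m → Subset k → Subset (m * k)
  p ⊗ q = tabulate λ x → lookup p (row x) ∧ lookup q (col x)

  ∈-⊗ : (p : Subset m) (q : Subset k) (x : Fin (m * k)) →
        x ∈ p ⊗ q ⇔ (row x ∈ p × col x ∈ q)
  ∈-⊗ p q x = mk⇔ to from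
    where
    entry : lookup (p ⊗ q) x ≡ lookup p (row x) ∧ lookup q (col x)
    entry = lookup∘tabulate _ x

    to : x ∈ p ⊗ q → row x ∈ p × col x ∈ q
    to x∈ with Equivalence.to ∧≡true⇔ (trans (sym entry) (Equivalence.to ∈⇔lookup x∈))
    ... | inp , inq = Equivalence.from ∈⇔lookup inp , Equivalence.from ∈⇔lookup inq

    from : row x ∈ p × col x ∈ q → x ∈ p ⊗ q
    from (inp , inq) = Equivalence.from ∈⇔lookup
      (trans entry (Equivalence.from ∧≡true⇔
        (Equivalence.to ∈⇔lookup inp , Equivalence.to ∈⇔lookup inq)))

  combine-∈-⊗ : {p : Subset m} {q : Subset k} {i : Fin m} {j : Fin k} →
                i ∈ p → j ∈ q → combine i j ∈ p ⊗ q
  combine-∈-⊗ {p} {q} {i} {j} i∈p j∈q =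
    Equivalence.from (∈-⊗ p q (combine i j))
      (subst (λ ij → proj₁ ij ∈ p × proj₂ ij ∈ q)
             (sym (remQuot-combine {m} {k} i j)) (i∈p , j∈q))

  ⊗-meet⇔ : (p p′ : Subset m) (q q′ : Subset k) →
            Nonempty ((p ⊗ q) ∩ (p′ ⊗ q′)) ⇔ (Nonempty (p ∩ p′) × Nonempty (q ∩ q′))
  ⊗-meet⇔ p p′ q q′ = mk⇔ to from
    where
    to : Nonempty ((p ⊗ q) ∩ (p′ ⊗ q′)) → Nonempty (p ∩ p′) × Nonempty (q ∩ q′)
    to (x , x∈) with x∈p∩q⁻ (p ⊗ q) (p′ ⊗ q′) x∈
    ... | x∈pq , x∈p′q′ with Equivalence.to (∈-⊗ p q x) x∈pq | Equivalence.to (∈-⊗ p′ q′ x) x∈p′q′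
    ... | r∈p , c∈q | r∈p′ , c∈q′ = (row x , x∈p∩q⁺ (r∈p , r∈p′)) , (col x , x∈p∩q⁺ (c∈q , c∈q′))

    from : Nonempty (p ∩ p′) × Nonempty (q ∩ q′) → Nonempty ((p ⊗ q) ∩ (p′ ⊗ q′))
    from ((i , i∈) , (j , j∈)) with x∈p∩q⁻ p p′ i∈ | x∈p∩q⁻ q q′ j∈
    ... | i∈p , i∈p′ | j∈q , j∈q′ =
      combine i j , x∈p∩q⁺ (combine-∈-⊗ i∈p j∈q , combine-∈-⊗ i∈p′ j∈q′)

cir⇒ir : {G : Graph} {α β : ℕ} → CIR G α β → IR G (α * β)
cir⇒ir C = record
  { S   = λ v → A v ⊗ B v
  ; rep = λ u v u≢v → ⇔-sym (⊗-meet⇔ (A u) (A v) (B u) (B v)) ⇔-∘ rep u v u≢v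
  }
  where open CIR C

θ₁≤αβ : (G : Graph) (α β : ℕ) → 1 ≤ α → 1 ≤ β → CIR G α β →
        (θ₁ : ℕ) → IsIntersectionNumber G θ₁ → θ₁ ≤ α * β
θ₁≤αβ G α β 1≤α 1≤β C θ₁ (_ , minimal) = minimal (α * β) (*-mono-≤ 1≤α 1≤β) (cir⇒ir C)

lemma3 : (G : Graph) →
    ((α β : ℕ) → 1 ≤ α → 1 ≤ β → CIR G α β →
    (θ₁ : ℕ) → IsIntersectionNumber G θ₁ → θ₁ ≤ α * β)
    × ((θᶜ θ₁ : ℕ) → IsCointersectionNumber G θᶜ → IsIntersectionNumber G θ₁ →
    ∃[ α ] ∃[ β ] (1 ≤ α × 1 ≤ β × θ₁ ≤ α * β × α + β ≤ θᶜ))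
lemma3 G = θ₁≤αβ G , consequence
  where
  consequence : (θᶜ θ₁ : ℕ) → IsCointersectionNumber G θᶜ → IsIntersectionNumber G θ₁ →
                ∃[ α ] ∃[ β ] (1 ≤ α × 1 ≤ β × θ₁ ≤ α * β × α + β ≤ θᶜ)
  consequence θᶜ θ₁ ((α , β , 1≤α , 1≤β , α+β≡θᶜ , C) , _) isθ₁ =
    α , β , 1≤α , 1≤β , θ₁≤αβ G α β 1≤α 1≤β C θ₁ isθ₁ , ≤-reflexive α+β≡θᶜ
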